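{- Let $g\ge4$ be even and let $p_1,\dots,p_r$ be distinct odd primes, each relatively prime to $g$. For each $i$ let $j_i\ge0$ be the largest integer such that $p_i^{j_i}$ divides $\operatorname{lcm}(o_g(p_1),\dots,o_g(p_r))$. Assume that $p_1^{\iota_g(p_1)+j_1}p_2^{\iota_g(p_2)+j_2}\cdots p_r^{\iota_g(p_r)+j_r}$ is complete. Then $p_1^{k_1}\cdots p_r^{k_r}$ is complete for all integers $k_1,\dots,k_r\ge0$.
   Context: For an odd integer $m\ge1$, an extreme cycle for the digit set $\{0,m\}$ (with respect to the even integer $g\ge4$) is a finite set of distinct integers $\{x_0,\dots,x_{r-1}\}$ together with digits $l_0,\dots,l_{r-1}\in\{0,m\}$ such that $x_{j+1}=(x_j+l_j)/g$ for $0\le j\le r-2$ and $x_0=(x_{r-1}+l_{r-1})/g$. The cycle $\{0\}$ is the trivial extreme cycle. $m$ is complete if the only extreme cycle for $\{0,m\}$ is the trivial one. For $m$ coprime to $g$, $o_g(m)$ denotes the order of $g$ in $U(\mathbb{Z}_m)$. For an odd prime $p$ coprime to $g$, $\iota_g(p)$ denotes the largest integer $l\ge1$ such that $o_g(p^l)=o_g(p)$. -}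

module Defs where

open import Data.Nat using (ℕ; zero; suc; _*_; _^_; _∸_; _≤_)
open import Data.Nat.Divisibility using (_∣_)
open import Data.Nat.LCM using (lcm)
open import Data.Integer as ℤ using (ℤ; +_)
open import Data.Fin using (Fin; zero; suc; inject₁; fromℕ)
open import Data.List using (List; foldr; map; allFin)
open import Data.Nat.ListAction using (product)
open import Data.Product using (_×_)
open import Data.Sum using (_⊎_)
open import Function.Definitions using (Injective)
open import Relation.Binary.PropositionalEquality using (_≡_)

-- An extreme cycle of length r = suc n for the digit set {0,m} w.r.t. g:
-- distinct integers x_0..x_n, digits l_j ∈ {0,m}, with
--   x_{j+1} = (x_j + l_j)/g  (0 ≤ j ≤ n-1)   and   x_0 = (x_n + l_n)/g,
-- where "y = z/g" means the exact equation g·y = z.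
record ExtremeCycle (g m : ℕ) : Set where
  field
    n      : ℕ
    x      : Fin (suc n) → ℤ
    l      : Fin (suc n) → ℤ
    distinct : Injective _≡_ _≡_ x
    digit  : ∀ j → l j ≡ + 0 ⊎ l j ≡ + m
    step   : ∀ (j : Fin n) → (+ g) ℤ.* x (suc j) ≡ x (inject₁ j) ℤ.+ l (inject₁ j)
    close  : (+ g) ℤ.* x zero ≡ x (fromℕ n) ℤ.+ l (fromℕ n)

-- m is complete: every extreme cycle is the trivial one, i.e. its set of
-- elements is {0} (every element is 0; distinctness then forces length 1).
Complete : ℕ → ℕ → Set
Complete g m = (c : ExtremeCycle g m) → ∀ j → ExtremeCycle.x c j ≡ + 0

IsOrder : ℕ → ℕ → ℕ → Set
IsOrder g m k = 1 ≤ k × m ∣ (g ^ k ∸ 1) × (∀ k′ → 1 ≤ k′ → m ∣ (g ^ k′ ∸ 1) → k ≤ k′)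

IsIota : ℕ → ℕ → ℕ → ℕ → Set
IsIota g p op ι = 1 ≤ ι × IsOrder g (p ^ ι) op × (∀ l′ → 1 ≤ l′ → IsOrder g (p ^ l′) op → l′ ≤ ι)

IsMaxExp : ℕ → ℕ → ℕ → Set
IsMaxExp p L j = p ^ j ∣ L × (∀ j′ → p ^ j′ ∣ L → j′ ≤ j)

lcmFin : ∀ r → (Fin r → ℕ) → ℕ
lcmFin r f = foldr lcm 1 (map f (allFin r))

prodFin : ∀ r → (Fin r → ℕ) → ℕ
prodFin r f = product (map f (allFin r))

-- Suppose some exponent e i of m = ∏ p i ^ e i exceeds ι i + j i, and put P = p i and u = m / P. Lifting the
-- exponent from o i (where P ^ ι i exactly divides g ^ o i − 1) yields n with g ^ n = 1 + s u and P ∤ s. Walking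
-- an extreme cycle for m backwards n steps at a time gives elements z₀, z₁, … with g ^ n z (i + 1) ≡ z i
-- (mod m); they all lie in [0, m / 3] and agree modulo u, so two of z₀, …, z (P − 1) coincide, while
-- (1 + s u) ^ d ≡ 1 + d s u (mod m) then forces P ∣ z₀. Hence P divides every element of the cycle, and dividing
-- by P gives an extreme cycle for u. Descending this way, a non-trivial extreme cycle for ∏ p i ^ k i yields
-- one for a divisor of ∏ p i ^ (ι i + j i), and scaling it up gives one for that number itself.

module Submission where

open import Defs

-- Extreme cycles

module ExtremeCycles where

  open import Data.Nat as ℕ using (ℕ; zero; suc)
  import Data.Nat.Divisibility as ℕ
  import Data.Nat.Properties as ℕ
  open import Data.Integer hiding (suc; NonZero)
  open import Data.Integer.Base using (NonZero)
  open import Data.Integer.Properties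
  import Data.Integer.Divisibility.Signed as ℤ
  open import Data.Integer.Tactic.RingSolver using (solve-∀)
  open import Data.Fin using (Fin; zero; suc; inject₁; fromℕ)
  open import Data.Product using (Σ; ∃-syntax; _×_; _,_; proj₁; proj₂)
  open import Data.Sum as Sum using (_⊎_; inj₁; inj₂)
  open import Function using (_∘_)
  open import Relation.Nullary using (¬_)
  open import Relation.Binary.PropositionalEquality

  NontrivialCycle : ℕ → ℕ → Set
  NontrivialCycle g m = Σ (ExtremeCycle g m) λ c → ∃[ j ] ExtremeCycle.x c j ≢ + 0

  complete⇒¬nontrivial : ∀ {g m} → Complete g m → ¬ NontrivialCycle g m
  complete⇒¬nontrivial complete (c , j , xj≢0) = xj≢0 (complete c j)

  fromℕ⊎inject₁ : ∀ {n} (b : Fin (suc n)) → b ≡ fromℕ n ⊎ ∃[ j ] b ≡ inject₁ j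
  fromℕ⊎inject₁ {zero}  zero    = inj₁ refl
  fromℕ⊎inject₁ {suc n} zero    = inj₂ (zero , refl)
  fromℕ⊎inject₁ {suc n} (suc b) with fromℕ⊎inject₁ b
  ... | inj₁ b≡n       = inj₁ (cong suc b≡n)
  ... | inj₂ (j , b≡j) = inj₂ (suc j , cong suc b≡j)

  step-scale : ∀ g q a b c → + g * a ≡ b + c → + g * (q * a) ≡ q * b + q * c
  step-scale g q a b c eq = trans (ring (+ g) q a) (trans (cong (q *_) eq) (*-distribˡ-+ q b c))
    where
    ring : ∀ g q a → g * (q * a) ≡ q * (g * a)
    ring = solve-∀

  step-unscale : ∀ g q a b c .{{_ : NonZero q}} → + g * (q * a) ≡ q * b + q * c → + g * a ≡ b + c
  step-unscale g q a b c eq = *-cancelˡ-≡ q (+ g * a) (b + c)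
    (trans (ring (+ g) q a) (trans eq (sym (*-distribˡ-+ q b c))))
    where
    ring : ∀ g q a → q * (g * a) ≡ g * (q * a)
    ring = solve-∀

  nontrivial-* : ∀ {g m} q .{{_ : ℕ.NonZero q}} → NontrivialCycle g m → NontrivialCycle g (q ℕ.* m)
  nontrivial-* {g} {m} q (c , j₀ , xj₀≢0) =
    c′ , j₀ , λ qxj₀≡0 → xj₀≢0 (*-cancelˡ-≡ (+ q) _ _ (trans qxj₀≡0 (sym (*-zeroʳ (+ q)))))
    where
    open ExtremeCycle c
    c′ : ExtremeCycle g (q ℕ.* m)
    c′ = record
      { n        = n
      ; x        = λ j → + q * x j
      ; l        = λ j → + q * l j
      ; distinct = λ eq → distinct (*-cancelˡ-≡ (+ q) _ _ eq)
      ; digit    = λ j → Sum.map (λ lj≡0 → trans (cong (+ q *_) lj≡0) (*-zeroʳ (+ q)))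
                                 (λ lj≡m → trans (cong (+ q *_) lj≡m) (sym (pos-* q m))) (digit j)
      ; step     = λ j → step-scale g (+ q) _ _ _ (step j)
      ; close    = step-scale g (+ q) _ _ _ close
      }

  nontrivial-divideOut : ∀ {g m} q .{{_ : ℕ.NonZero q}} (c : ExtremeCycle g (q ℕ.* m)) →
    (∀ j → + q ℤ.∣ ExtremeCycle.x c j) → ∃[ j ] ExtremeCycle.x c j ≢ + 0 → NontrivialCycle g m
  nontrivial-divideOut {g} {m} q c q∣x (j₀ , xj₀≢0) =
    c′ , j₀ , λ yj₀≡0 → xj₀≢0 (trans (x≡q*y j₀) (trans (cong (+ q *_) yj₀≡0) (*-zeroʳ (+ q))))
    where
    open ExtremeCycle c
    y : Fin (suc n) → ℤ
    y j = ℤ._∣_.quotient (q∣x j)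
    x≡q*y : ∀ j → x j ≡ + q * y j
    x≡q*y j = trans (ℤ._∣_.equality (q∣x j)) (*-comm (y j) (+ q))
    digit÷q : ∀ j → ∃[ δ ] l j ≡ + q * δ × (δ ≡ + 0 ⊎ δ ≡ + m)
    digit÷q j with digit j
    ... | inj₁ lj≡0  = + 0 , trans lj≡0 (sym (*-zeroʳ (+ q))) , inj₁ refl
    ... | inj₂ lj≡qm = + m , trans lj≡qm (pos-* q m) , inj₂ refl
    δ : Fin (suc n) → ℤ
    δ j = proj₁ (digit÷q j)
    unscale : ∀ {a b} → + g * x a ≡ x b + l b → + g * y a ≡ y b + δ b
    unscale {a} {b} eq = step-unscale g (+ q) (y a) (y b) (δ b)
      (subst₂ (λ u v → + g * u ≡ v) (x≡q*y a) (cong₂ _+_ (x≡q*y b) (proj₁ (proj₂ (digit÷q b)))) eq)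
    c′ : ExtremeCycle g m
    c′ = record
      { n        = n
      ; x        = y
      ; l        = δ
      ; distinct = λ {i} {j} eq → distinct (trans (x≡q*y i) (trans (cong (+ q *_) eq) (sym (x≡q*y j))))
      ; digit    = λ j → proj₂ (proj₂ (digit÷q j))
      ; step     = λ j → unscale (step j)
      ; close    = unscale close
      }

  argmin : ∀ n (f : Fin (suc n) → ℤ) → ∃[ a ] ∀ j → f a ≤ f j
  argmin zero    f = zero , λ { zero → ≤-refl }
  argmin (suc n) f with argmin n (f ∘ suc)
  ... | a , fa≤ with ≤-total (f zero) (f (suc a))
  ...   | inj₁ f0≤fa = zero  , λ { zero → ≤-refl ; (suc j) → ≤-trans f0≤fa (fa≤ j) }
  ...   | inj₂ fa≤f0 = suc a , λ { zero → fa≤f0  ; (suc j) → fa≤ j }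

  argmax : ∀ n (f : Fin (suc n) → ℤ) → ∃[ a ] ∀ j → f j ≤ f a
  argmax n f with argmin n (-_ ∘ f)
  ... | a , -fa≤ = a , λ j → subst₂ _≤_ (neg-involutive (f j)) (neg-involutive (f a)) (neg-mono-≤ (-fa≤ j))

  private
    +-cancelˡ-≤ : ∀ a b c → a + b ≤ a + c → b ≤ c
    +-cancelˡ-≤ a b c a+b≤a+c = subst₂ _≤_ (ring a b) (ring a c) (+-monoʳ-≤ (- a) a+b≤a+c)
      where
      ring : ∀ a b → - a + (a + b) ≡ b
      ring = solve-∀

  module CycleBounds {g′ m : ℕ} (c : ExtremeCycle (suc g′) m) where
    open ExtremeCycle c

    successor : ∀ a → ∃[ b ] + suc g′ * x a ≡ x b + l b
    successor zero    = fromℕ n , close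
    successor (suc j) = inject₁ j , step j

    predecessor : ∀ b → ∃[ a ] + suc g′ * x a ≡ x b + l b
    predecessor b with fromℕ⊎inject₁ b
    ... | inj₁ refl       = zero , close
    ... | inj₂ (j , refl) = suc j , step j

    0≤l : ∀ b → 0ℤ ≤ l b
    0≤l b = Sum.[ (λ lb≡0 → ≤-reflexive (sym lb≡0)) , (λ lb≡m → subst (0ℤ ≤_) (sym lb≡m) (+≤+ ℕ.z≤n)) ] (digit b)

    l≤m : ∀ b → l b ≤ + m
    l≤m b = Sum.[ (λ lb≡0 → subst (_≤ + m) (sym lb≡0) (+≤+ ℕ.z≤n)) , ≤-reflexive ] (digit b)

    module _ .{{_ : Positive (+ g′)}} where

      0≤x : ∀ j → 0ℤ ≤ x j
      0≤x j with argmin n x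
      ... | a , xa≤ with successor a
      ...   | b , ga≡ = ≤-trans 0≤xa (xa≤ j)
        where
        xa+0≤xa+g′xa : x a + 0ℤ ≤ x a + + g′ * x a
        xa+0≤xa+g′xa = subst (x a + 0ℤ ≤_) (trans (sym ga≡) (suc-* (+ g′) (x a))) (+-mono-≤ (xa≤ b) (0≤l b))
        0≤xa : 0ℤ ≤ x a
        0≤xa = *-cancelˡ-≤-pos 0ℤ (x a) (+ g′)
          (subst (_≤ + g′ * x a) (sym (*-zeroʳ (+ g′))) (+-cancelˡ-≤ (x a) 0ℤ _ xa+0≤xa+g′xa))

      g′*x≤m : ∀ j → + g′ * x j ≤ + m
      g′*x≤m j with argmax n x
      ... | a , ≤xa with successor a
      ...   | b , ga≡ = ≤-trans (*-monoˡ-≤-nonNeg (+ g′) (≤xa j)) (+-cancelˡ-≤ (x a) _ (+ m) xa+g′xa≤xa+m)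
        where
        xa+g′xa≤xa+m : x a + + g′ * x a ≤ x a + + m
        xa+g′xa≤xa+m = subst (_≤ x a + + m) (trans (sym ga≡) (suc-* (+ g′) (x a))) (+-mono-≤ (≤xa b) (l≤m b))

      ∣x∣ : Fin (suc n) → ℕ
      ∣x∣ j = ∣ x j ∣

      +∣x∣≡x : ∀ j → + ∣x∣ j ≡ x j
      +∣x∣≡x j = 0≤i⇒+∣i∣≡i (0≤x j)

      g′*∣x∣≤m : ∀ j → g′ ℕ.* ∣x∣ j ℕ.≤ m
      g′*∣x∣≤m j = drop‿+≤+ (subst (_≤ + m) (trans (cong (+ g′ *_) (sym (+∣x∣≡x j))) (sym (pos-* g′ (∣x∣ j)))) (g′*x≤m j))

      l≡m*δ : ∀ b → ∃[ δ ] l b ≡ + (m ℕ.* δ)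
      l≡m*δ b = Sum.[ (λ lb≡0 → 0 , trans lb≡0 (cong +_ (sym (ℕ.*-zeroʳ m))))
                    , (λ lb≡m → 1 , trans lb≡m (cong +_ (sym (ℕ.*-identityʳ m)))) ] (digit b)

      predecessorℕ : ∀ b → ∃[ a ] ∃[ δ ] suc g′ ℕ.* ∣x∣ a ≡ ∣x∣ b ℕ.+ m ℕ.* δ
      predecessorℕ b with predecessor b | l≡m*δ b
      ... | a , ga≡ | δ , lb≡ = a , δ , +-injective (begin
        + (suc g′ ℕ.* ∣x∣ a)      ≡⟨ pos-* (suc g′) (∣x∣ a) ⟩
        + suc g′ * + ∣x∣ a         ≡⟨ cong (+ suc g′ *_) (+∣x∣≡x a) ⟩
        + suc g′ * x a             ≡⟨ ga≡ ⟩
        x b + l b                  ≡⟨ cong₂ _+_ (sym (+∣x∣≡x b)) lb≡ ⟩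
        + ∣x∣ b + + (m ℕ.* δ)      ≡⟨ sym (pos-+ (∣x∣ b) (m ℕ.* δ)) ⟩
        + (∣x∣ b ℕ.+ m ℕ.* δ)      ∎)
        where open ≡-Reasoning

  nontrivial-∣ : ∀ {g m n} .{{_ : ℕ.NonZero n}} → m ℕ.∣ n → NontrivialCycle g m → NontrivialCycle g n
  nontrivial-∣ (ℕ.divides q refl) = nontrivial-* q {{ℕ.m*n≢0⇒m≢0 q}}

open ExtremeCycles

open import Data.Nat
open import Data.Nat.Properties
open import Data.Nat.Divisibility
open import Data.Nat.DivMod
open import Data.Nat.Primality
open import Data.Nat.Coprimality using (Coprime)
open import Data.Nat.LCM using (lcm; m∣lcm[m,n]; n∣lcm[m,n])
open import Data.Nat.ListAction using (product)
open import Data.Nat.ListAction.Properties using (∈⇒∣product)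
open import Data.Nat.Tactic.RingSolver using (solve-∀)
import Data.Integer as ℤ
import Data.Integer.Divisibility.Signed as ℤ
open import Data.Fin as Fin using (Fin; zero; suc; toℕ; fromℕ<)
import Data.Fin.Properties as Fin
open import Data.List using (_∷_; map; allFin; foldr)
open import Data.List.Properties using (map-tabulate; map-cong)
open import Data.List.Membership.Propositional using (_∈_)
open import Data.List.Membership.Propositional.Properties using (∈-map⁺; ∈-allFin)
open import Data.List.Relation.Unary.Any using (here; there)
open import Data.Vec.Functional using (updateAt)
open import Data.Vec.Functional.Properties using (updateAt-updates; updateAt-minimal; updateAt-updateAt-local; updateAt-id)
open import Data.Product using (∃-syntax; _×_; _,_; proj₁)
open import Data.Sum using (inj₁; inj₂)
open import Function using (_∘_; id; const)
open import Function.Definitions using (Injective)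
open import Relation.Nullary using (¬_; yes; no; contradiction)
open import Relation.Binary.PropositionalEquality

prime>1 : ∀ {p} → Prime p → 1 < p
prime>1 {p} pp = nonTrivial⇒n>1 p {{prime⇒nonTrivial pp}}

prime∤1 : ∀ {p} → Prime p → ¬ p ∣ 1
prime∤1 pp p∣1 = nonTrivial⇒≢1 {{prime⇒nonTrivial pp}} (∣1⇒≡1 p∣1)

prime∤*⁺ : ∀ {p m n} → Prime p → ¬ p ∣ m → ¬ p ∣ n → ¬ p ∣ m * n
prime∤*⁺ {m = m} {n} pp p∤m p∤n p∣mn with euclidsLemma m n pp p∣mn
... | inj₁ p∣m = p∤m p∣m
... | inj₂ p∣n = p∤n p∣n

prime∣prime^⇒≡ : ∀ {p q} → Prime p → Prime q → ∀ f → p ∣ q ^ f → p ≡ q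
prime∣prime^⇒≡ pp pq zero    p∣1 = contradiction p∣1 (prime∤1 pp)
prime∣prime^⇒≡ {q = q} pp pq (suc f) p∣q^f+1 with euclidsLemma q (q ^ f) pp p∣q^f+1
... | inj₂ p∣q^f = prime∣prime^⇒≡ pp pq f p∣q^f
... | inj₁ p∣q with prime⇒irreducible pq p∣q
...   | inj₂ p≡q  = p≡q
...   | inj₁ refl = contradiction ∣-refl (prime∤1 pp)

^-monoʳ-∣ : ∀ q {a b} → a ≤ b → q ^ a ∣ q ^ b
^-monoʳ-∣ q {a} {b} a≤b =
  divides (q ^ (b ∸ a)) (trans (cong (q ^_) (sym (m∸n+n≡m a≤b))) (^-distribˡ-+-* q (b ∸ a) a))

p∣p^ : ∀ p {m} → 1 ≤ m → p ∣ p ^ m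
p∣p^ p (s≤s _) = m∣m*n _

prime^∣∧∣⇒*∣ : ∀ {p b n} → Prime p → ¬ p ∣ b → ∀ k → p ^ k ∣ n → b ∣ n → p ^ k * b ∣ n
prime^∣∧∣⇒*∣ {b = b} pp p∤b zero    _ b∣n = subst (_∣ _) (sym (*-identityˡ b)) b∣n
prime^∣∧∣⇒*∣ {p} {b} pp p∤b (suc k) p^k+1∣n b∣n
  with prime^∣∧∣⇒*∣ pp p∤b k (∣-trans (n∣m*n p) p^k+1∣n) b∣n
... | divides c refl with euclidsLemma c b pp (*-cancelˡ-∣ (p ^ k) {{m^n≢0 p k}} p^k*p∣p^k*cb)
  where
  instance _ = prime⇒nonZero pp
  p^k*p∣p^k*cb : p ^ k * p ∣ p ^ k * (c * b)
  p^k*p∣p^k*cb = subst₂ _∣_ (*-comm p (p ^ k)) (ring c (p ^ k) b) p^k+1∣n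
    where
    ring : ∀ c P b → c * (P * b) ≡ P * (c * b)
    ring = solve-∀
... | inj₂ p∣b = contradiction p∣b p∤b
... | inj₁ (divides c′ refl) = divides c′ (ring c′ p (p ^ k) b)
  where
  ring : ∀ c p P b → c * p * (P * b) ≡ c * (p * P * b)
  ring = solve-∀

geometricSum : ℕ → ℕ → ℕ
geometricSum z zero    = 0
geometricSum z (suc k) = suc (z * geometricSum z k)

triangle : ℕ → ℕ
triangle zero    = 0
triangle (suc k) = k + triangle k

[1+d]^k≡1+d*geometricSum : ∀ d k → suc d ^ k ≡ suc (d * geometricSum (suc d) k)
[1+d]^k≡1+d*geometricSum d zero    = cong suc (sym (*-zeroʳ d))
[1+d]^k≡1+d*geometricSum d (suc k) rewrite [1+d]^k≡1+d*geometricSum d k = ring d (geometricSum (suc d) k)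
  where
  ring : ∀ d s → suc d * suc (d * s) ≡ suc (d * suc (suc d * s))
  ring = solve-∀

geometricSum≡k+d*t : ∀ d k → ∃[ t ] geometricSum (suc d) k ≡ k + d * t
geometricSum≡k+d*t d zero    = 0 , sym (*-zeroʳ d)
geometricSum≡k+d*t d (suc k) with geometricSum≡k+d*t d k
... | t , eq rewrite eq = k + t + d * t , ring d k t
  where
  ring : ∀ d k t → suc (suc d * (k + d * t)) ≡ suc k + d * (k + t + d * t)
  ring = solve-∀

geometricSum≡k+d*triangle+d*d*t : ∀ d k → ∃[ t ] geometricSum (suc d) k ≡ k + d * triangle k + d * d * t
geometricSum≡k+d*triangle+d*d*t d zero    = 0 , sym (cong₂ _+_ (*-zeroʳ d) (*-zeroʳ (d * d)))
geometricSum≡k+d*triangle+d*d*t d (suc k) with geometricSum≡k+d*triangle+d*d*t d k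
... | t , eq rewrite eq = triangle k + t + d * t , ring d k (triangle k) t
  where
  ring : ∀ d k Δ t → suc (suc d * (k + d * Δ + d * d * t)) ≡ suc k + d * (k + Δ) + d * d * (Δ + t + d * t)
  ring = solve-∀

2*triangle[1+k]≡[1+k]*k : ∀ k → 2 * triangle (suc k) ≡ suc k * k
2*triangle[1+k]≡[1+k]*k zero    = refl
2*triangle[1+k]≡[1+k]*k (suc k) = begin
  2 * (suc k + triangle (suc k))    ≡⟨ *-distribˡ-+ 2 (suc k) (triangle (suc k)) ⟩
  2 * suc k + 2 * triangle (suc k)  ≡⟨ cong (2 * suc k +_) (2*triangle[1+k]≡[1+k]*k k) ⟩
  2 * suc k + suc k * k             ≡⟨ ring k ⟩
  suc (suc k) * suc k               ∎
  where
  open ≡-Reasoning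
  ring : ∀ k → 2 * suc k + suc k * k ≡ suc (suc k) * suc k
  ring = solve-∀

odd-prime∣triangle : ∀ {p} → Prime p → ¬ 2 ∣ p → p ∣ triangle p
odd-prime∣triangle {suc k} pp 2∤p
  with euclidsLemma 2 (triangle (suc k)) pp (subst (suc k ∣_) (sym (2*triangle[1+k]≡[1+k]*k k)) (m∣m*n k))
... | inj₂ p∣triangle = p∣triangle
... | inj₁ p∣2 = contradiction (subst (_∣ suc k) (≤-antisym (∣⇒≤ p∣2) (prime>1 pp)) ∣-refl) 2∤p

-- Powers congruent to 1

infix 4 _≡1[mod_] _≡1[mod_^_]exactly

_≡1[mod_] : ℕ → ℕ → Set
z ≡1[mod m ] = ∃[ w ] z ≡ suc (w * m)

_≡1[mod_^_]exactly : ℕ → ℕ → ℕ → Set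
z ≡1[mod p ^ a ]exactly = ∃[ w ] z ≡ suc (w * p ^ a) × ¬ p ∣ w

∣∸1⇒≡1[mod] : ∀ {m z} → 1 ≤ z → m ∣ z ∸ 1 → z ≡1[mod m ]
∣∸1⇒≡1[mod] {z = suc _} _ (divides w eq) = w , cong suc eq

≡1[mod]⇒∣∸1 : ∀ {m z} → z ≡1[mod m ] → m ∣ z ∸ 1
≡1[mod]⇒∣∸1 (w , refl) = divides w refl

≡1[mod]-∣ : ∀ {d m z} → d ∣ m → z ≡1[mod m ] → z ≡1[mod d ]
≡1[mod]-∣ {d} (divides c refl) (w , refl) = w * c , cong suc (sym (*-assoc w c d))

≡1[mod]exactly⇒≡1[mod] : ∀ {p a z} → z ≡1[mod p ^ a ]exactly → z ≡1[mod p ^ a ]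
≡1[mod]exactly⇒≡1[mod] (w , z≡ , _) = w , z≡

^-≡1[mod] : ∀ {m z} → z ≡1[mod m ] → ∀ k → z ^ k ≡1[mod m ]
^-≡1[mod] {m} (w , refl) k = w * geometricSum (suc (w * m)) k ,
  trans ([1+d]^k≡1+d*geometricSum (w * m) k) (cong suc (ring w m _))
  where
  ring : ∀ w m s → w * m * s ≡ w * s * m
  ring = solve-∀

^-lift-≡1[mod] : ∀ {q m z} → z ≡1[mod q * m ] → z ^ q ≡1[mod q * (q * m)]
^-lift-≡1[mod] {q} {m} (w , refl) with geometricSum≡k+d*t (w * (q * m)) q
... | t , eq = w * (1 + w * m * t) ,
  trans ([1+d]^k≡1+d*geometricSum d q) (cong suc (trans (cong (d *_) eq) (ring w q m t)))
  where
  d = w * (q * m)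
  ring : ∀ w q m t → w * (q * m) * (q + w * (q * m) * t) ≡ w * (1 + w * m * t) * (q * (q * m))
  ring = solve-∀

^-lift*-≡1[mod] : ∀ {q z} → z ≡1[mod q ] → ∀ e → z ^ (q ^ e) ≡1[mod q ^ suc e ]
^-lift*-≡1[mod] {q} {z} z≡1 zero = subst₂ _≡1[mod_] (sym (*-identityʳ z)) (sym (*-identityʳ q)) z≡1
^-lift*-≡1[mod] {q} {z} z≡1 (suc e) =
  subst (_≡1[mod q ^ suc (suc e)]) (trans (^-*-assoc z (q ^ e) q) (cong (z ^_) (*-comm (q ^ e) q)))
    (^-lift-≡1[mod] {q} {q ^ e} (^-lift*-≡1[mod] z≡1 e))

^-coprime-≡1[mod]exactly : ∀ {p a z k} → Prime p → ¬ p ∣ k →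
  z ≡1[mod p ^ suc a ]exactly → z ^ k ≡1[mod p ^ suc a ]exactly
^-coprime-≡1[mod]exactly {p} {a} {k = k} pp p∤k (v , refl , p∤v) with geometricSum≡k+d*t (v * (p * p ^ a)) k
... | t , eq = v * (k + v * p ^ a * t * p) ,
  trans ([1+d]^k≡1+d*geometricSum d k) (cong suc (trans (cong (d *_) eq) (ring v p (p ^ a) k t))) ,
  prime∤*⁺ pp p∤v (λ p∣ → p∤k (∣m+n∣m⇒∣n (subst (p ∣_) (+-comm k _) p∣) (n∣m*n (v * p ^ a * t))))
  where
  d = v * (p * p ^ a)
  ring : ∀ v p P k t → v * (p * P) * (k + v * (p * P) * t) ≡ v * (k + v * P * t * p) * (p * P)
  ring = solve-∀

-- Oddness of p enters only here, through p ∣ triangle p = p (p − 1) / 2.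
^-prime-≡1[mod]exactly : ∀ {p a z} → Prime p → ¬ 2 ∣ p →
  z ≡1[mod p ^ suc a ]exactly → z ^ p ≡1[mod p ^ suc (suc a) ]exactly
^-prime-≡1[mod]exactly {p} {a} pp 2∤p (v , refl , p∤v)
  with odd-prime∣triangle pp 2∤p | geometricSum≡k+d*triangle+d*d*t (v * (p * p ^ a)) p
... | divides c triangle≡ | t , eq = v * (1 + p * X) ,
  trans ([1+d]^k≡1+d*geometricSum d p)
    (cong suc (trans (cong (d *_) (trans eq (cong (λ Δ → p + d * Δ + d * d * t) triangle≡))) (ring v p (p ^ a) c t))) ,
  prime∤*⁺ pp p∤v (λ p∣ → prime∤1 pp (∣m+n∣m⇒∣n (subst (p ∣_) (+-comm 1 _) p∣) (m∣m*n X)))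
  where
  d = v * (p * p ^ a)
  X = v * p ^ a * c + v * v * p ^ a * p ^ a * t
  ring : ∀ v p P c t → v * (p * P) * (p + v * (p * P) * (c * p) + v * (p * P) * (v * (p * P)) * t)
                     ≡ v * (1 + p * (v * P * c + v * v * P * P * t)) * (p * (p * P))
  ring = solve-∀

^-prime^-≡1[mod]exactly : ∀ {p a z} → Prime p → ¬ 2 ∣ p →
  z ≡1[mod p ^ suc a ]exactly → ∀ t → z ^ (p ^ t) ≡1[mod p ^ (suc a + t) ]exactly
^-prime^-≡1[mod]exactly {p} {a} {z} pp 2∤p z≡1 zero =
  subst₂ (λ y b → y ≡1[mod p ^ b ]exactly) (sym (*-identityʳ z)) (sym (+-identityʳ (suc a))) z≡1
^-prime^-≡1[mod]exactly {p} {a} {z} pp 2∤p z≡1 (suc t) =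
  subst₂ (λ y b → y ≡1[mod p ^ b ]exactly)
    (trans (^-*-assoc z (p ^ t) p) (cong (z ^_) (*-comm (p ^ t) p))) (sym (+-suc (suc a) t))
    (^-prime-≡1[mod]exactly {a = a + t} pp 2∤p (^-prime^-≡1[mod]exactly {a = a} pp 2∤p z≡1 t))

^-prime^-coprime-≡1[mod]exactly : ∀ {p a z C} → Prime p → ¬ 2 ∣ p → 1 ≤ a → ¬ p ∣ C →
  z ≡1[mod p ^ a ]exactly → ∀ t → (z ^ (p ^ t)) ^ C ≡1[mod p ^ (a + t) ]exactly
^-prime^-coprime-≡1[mod]exactly {a = suc a} pp 2∤p _ p∤C z≡1 t =
  ^-coprime-≡1[mod]exactly {a = a + t} pp p∤C (^-prime^-≡1[mod]exactly {a = a} pp 2∤p z≡1 t)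

≡1[mod]exactly⇒cofactor : ∀ {p a m z} → Prime p → p ^ a ∣ m → m ∣ z ∸ 1 →
  z ≡1[mod p ^ a ]exactly → ∃[ s ] z ≡ suc (s * m) × ¬ p ∣ s
≡1[mod]exactly⇒cofactor {p} {a} pp (divides c refl) (divides s z∸1≡) (v , refl , p∤v) =
  s , cong suc z∸1≡ , λ p∣s → p∤v (subst (p ∣_) (sym v≡s*c) (∣m⇒∣m*n c p∣s))
  where
  instance _ = m^n≢0 p a {{prime⇒nonZero pp}}
  v≡s*c : v ≡ s * c
  v≡s*c = *-cancelʳ-≡ v (s * c) (p ^ a) (trans z∸1≡ (sym (*-assoc s c (p ^ a))))

order⇒≡1[mod] : ∀ {g q o} .{{_ : NonZero g}} → IsOrder g q o → g ^ o ≡1[mod q ]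
order⇒≡1[mod] {g} {o = o} (_ , q∣g^o∸1 , _) = ∣∸1⇒≡1[mod] (m^n>0 g o) q∣g^o∸1

order*^∣⇒≡1[mod] : ∀ {g q o n} .{{_ : NonZero g}} → IsOrder g q o → ∀ e → o * q ^ e ∣ n → g ^ n ≡1[mod q ^ e ]
order*^∣⇒≡1[mod] {g} {q} {o} isOrder e (divides c refl) =
  ≡1[mod]-∣ (n∣m*n q) (subst (_≡1[mod q ^ suc e ]) g^o^q^e^c≡g^n
    (^-≡1[mod] (^-lift*-≡1[mod] (order⇒≡1[mod] isOrder) e) c))
  where
  g^o^q^e^c≡g^n : ((g ^ o) ^ (q ^ e)) ^ c ≡ g ^ (c * (o * q ^ e))
  g^o^q^e^c≡g^n = trans (^-*-assoc (g ^ o) (q ^ e) c) (trans (^-*-assoc g o (q ^ e * c))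
    (cong (g ^_) (trans (sym (*-assoc o (q ^ e) c)) (*-comm (o * q ^ e) c))))

iota⇒≡1[mod]exactly : ∀ {g p o ι} .{{_ : NonZero g}} → IsOrder g p o → IsIota g p o ι →
  g ^ o ≡1[mod p ^ ι ]exactly
iota⇒≡1[mod]exactly {g} {p} {o} {ι} (_ , _ , o-least) (_ , (1≤o , p^ι∣ , _) , ι-greatest)
  with ∣∸1⇒≡1[mod] (m^n>0 g o) p^ι∣
... | w , g^o≡ = w , g^o≡ , p∤w
  where
  p∤w : ¬ p ∣ w
  p∤w (divides t refl) = <⇒≱ (n<1+n ι) (ι-greatest (suc ι) (s≤s z≤n) order[p^ι+1])
    where
    p^ι+1∣ : p ^ suc ι ∣ g ^ o ∸ 1
    p^ι+1∣ = subst (λ z → p ^ suc ι ∣ z ∸ 1) (sym g^o≡) (divides t (*-assoc t p (p ^ ι)))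
    order[p^ι+1] : IsOrder g (p ^ suc ι) o
    order[p^ι+1] = 1≤o , p^ι+1∣ , λ k 1≤k p^ι+1∣g^k∸1 → o-least k 1≤k (∣-trans (m∣m*n (p ^ ι)) p^ι+1∣g^k∸1)

prodFin-suc : ∀ r (f : Fin (suc r) → ℕ) → prodFin (suc r) f ≡ f zero * prodFin r (f ∘ suc)
prodFin-suc r f = cong (λ fs → f zero * product fs) (trans (map-tabulate suc f) (sym (map-tabulate id (f ∘ suc))))

prodFin-cong : ∀ r {f h : Fin r → ℕ} → (∀ i → f i ≡ h i) → prodFin r f ≡ prodFin r h
prodFin-cong r f≗h = cong product (map-cong f≗h (allFin r))

∣prodFin : ∀ r (f : Fin r → ℕ) i → f i ∣ prodFin r f
∣prodFin r f i = ∈⇒∣product (∈-map⁺ f (∈-allFin i))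

prodFin≢0 : ∀ r (f : Fin r → ℕ) → (∀ i → NonZero (f i)) → NonZero (prodFin r f)
prodFin≢0 zero    f f≢0 = _
prodFin≢0 (suc r) f f≢0 rewrite prodFin-suc r f =
  m*n≢0 (f zero) _ {{f≢0 zero}} {{prodFin≢0 r (f ∘ suc) (f≢0 ∘ suc)}}

prime∤prodFin : ∀ {p} r (f : Fin r → ℕ) → Prime p → (∀ i → ¬ p ∣ f i) → ¬ p ∣ prodFin r f
prime∤prodFin zero    f pp p∤f = prime∤1 pp
prime∤prodFin (suc r) f pp p∤f rewrite prodFin-suc r f =
  prime∤*⁺ pp (p∤f zero) (prime∤prodFin r (f ∘ suc) pp (p∤f ∘ suc))

prodFin-mono-∣ : ∀ r {f h : Fin r → ℕ} → (∀ i → f i ∣ h i) → prodFin r f ∣ prodFin r h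
prodFin-mono-∣ zero    f∣h = ∣-refl
prodFin-mono-∣ (suc r) {f} {h} f∣h rewrite prodFin-suc r f | prodFin-suc r h =
  *-pres-∣ (f∣h zero) (prodFin-mono-∣ r (f∣h ∘ suc))

prodFin-^-updateAt-suc : ∀ r (q e : Fin r → ℕ) i →
  prodFin r (λ k → q k ^ updateAt e i suc k) ≡ q i * prodFin r (λ k → q k ^ e k)
prodFin-^-updateAt-suc (suc r) q e zero
  rewrite prodFin-suc r (λ k → q k ^ updateAt e zero suc k) | prodFin-suc r (λ k → q k ^ e k) =
  *-assoc (q zero) _ _
prodFin-^-updateAt-suc (suc r) q e (suc i)
  rewrite prodFin-suc r (λ k → q k ^ updateAt e (suc i) suc k) | prodFin-suc r (λ k → q k ^ e k)
        | prodFin-^-updateAt-suc r (q ∘ suc) (e ∘ suc) i =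
  ring (q zero ^ e zero) (q (suc i)) _
  where
  ring : ∀ a b c → a * (b * c) ≡ b * (a * c)
  ring = solve-∀

prime-powers-∣ : ∀ r (q f : Fin r → ℕ) {n} → Injective _≡_ _≡_ q → (∀ i → Prime (q i)) →
  (∀ i → q i ^ f i ∣ n) → prodFin r (λ i → q i ^ f i) ∣ n
prime-powers-∣ zero    q f q-inj pq q^f∣n = 1∣ _
prime-powers-∣ (suc r) q f q-inj pq q^f∣n rewrite prodFin-suc r (λ i → q i ^ f i) =
  prime^∣∧∣⇒*∣ (pq zero) q₀∤rest (f zero) (q^f∣n zero)
    (prime-powers-∣ r (q ∘ suc) (f ∘ suc) (Fin.suc-injective ∘ q-inj) (pq ∘ suc) (q^f∣n ∘ suc))
  where
  q₀∤rest : ¬ q zero ∣ prodFin r (λ i → q (suc i) ^ f (suc i))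
  q₀∤rest = prime∤prodFin r _ (pq zero)
    (λ i q₀∣ → Fin.0≢1+n (q-inj (prime∣prime^⇒≡ (pq zero) (pq (suc i)) (f (suc i)) q₀∣)))

∈⇒∣foldr-lcm : ∀ {n ns} → n ∈ ns → n ∣ foldr lcm 1 ns
∈⇒∣foldr-lcm {ns = n ∷ ns} (here refl)  = m∣lcm[m,n] n _
∈⇒∣foldr-lcm {ns = m ∷ ns} (there n∈ns) = ∣-trans (∈⇒∣foldr-lcm n∈ns) (n∣lcm[m,n] m _)

∣lcmFin : ∀ r (f : Fin r → ℕ) i → f i ∣ lcmFin r f
∣lcmFin r f i = ∈⇒∣foldr-lcm (∈-map⁺ f (∈-allFin i))

maxExp⇒cofactor : ∀ {p L e} → IsMaxExp p L e → ∃[ L′ ] L ≡ L′ * p ^ e × ¬ p ∣ L′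
maxExp⇒cofactor {p} {L} {e} (divides L′ L≡ , e-greatest) = L′ , L≡ , p∤L′
  where
  p∤L′ : ¬ p ∣ L′
  p∤L′ (divides c refl) = <⇒≱ (n<1+n e) (e-greatest (suc e) (divides c (trans L≡ (*-assoc c p (p ^ e)))))

-- Backward orbits in extreme cycles

module _ {g′ m} (c : ExtremeCycle (suc g′) m) .{{_ : ℤ.Positive (ℤ.+ g′)}} where
  open CycleBounds c

  predecessor^ : ∀ s b → ∃[ a ] ∃[ k ] suc g′ ^ s * ∣x∣ a ≡ ∣x∣ b + m * k
  predecessor^ zero    b = b , 0 , trans (*-identityˡ (∣x∣ b)) (sym (trans (cong (∣x∣ b +_) (*-zeroʳ m)) (+-identityʳ (∣x∣ b))))
  predecessor^ (suc s) b with predecessor^ s b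
  ... | a′ , k , ga′≡ with predecessorℕ a′
  ...   | a , δ , ga≡ = a , k + G * δ , (begin
    suc g′ * G * ∣x∣ a            ≡⟨ ring₁ (suc g′) G (∣x∣ a) ⟩
    G * (suc g′ * ∣x∣ a)          ≡⟨ cong (G *_) ga≡ ⟩
    G * (∣x∣ a′ + m * δ)          ≡⟨ ring₂ G (∣x∣ a′) m δ ⟩
    G * ∣x∣ a′ + m * (G * δ)      ≡⟨ cong (_+ m * (G * δ)) ga′≡ ⟩
    ∣x∣ b + m * k + m * (G * δ)   ≡⟨ ring₃ (∣x∣ b) m k (G * δ) ⟩
    ∣x∣ b + m * (k + G * δ)       ∎)
    where
    open ≡-Reasoning
    G = suc g′ ^ s
    ring₁ : ∀ g G X → g * G * X ≡ G * (g * X)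
    ring₁ = solve-∀
    ring₂ : ∀ G Y m δ → G * (Y + m * δ) ≡ G * Y + m * (G * δ)
    ring₂ = solve-∀
    ring₃ : ∀ X m k d → X + m * k + m * d ≡ X + m * (k + d)
    ring₃ = solve-∀

-- (1 + s u)^d = 1 + d s u + (s u)^2 t, and P u ∣ (s u)^2 because P ∣ u.
^-fixes⇒∣ : ∀ {P u} .{{_ : NonZero u}} → P ∣ u → ∀ s d Z K →
  suc (s * u) ^ d * Z ≡ Z + P * u * K → P ∣ d * s * Z
^-fixes⇒∣ {P} {u} P∣u s d Z K fixes with geometricSum≡k+d*t (s * u) d
... | t , geo≡ =
  ∣m+n∣m⇒∣n (subst (P ∣_) (sym rest+dsZ≡PK) (m∣m*n K)) (∣-trans P∣u (divides (s * s * t * Z) (ring₂ s u t Z)))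
  where
  ring₁ : ∀ s u d t Z → suc (s * u * (d + s * u * t)) * Z ≡ Z + (s * u * s * t * Z + d * s * Z) * u
  ring₁ = solve-∀
  ring₂ : ∀ s u t Z → s * u * s * t * Z ≡ s * s * t * Z * u
  ring₂ = solve-∀
  ring₃ : ∀ Z P u K → Z + P * u * K ≡ Z + P * K * u
  ring₃ = solve-∀
  rest+dsZ≡PK : s * u * s * t * Z + d * s * Z ≡ P * K
  rest+dsZ≡PK = *-cancelʳ-≡ _ _ u (+-cancelˡ-≡ Z _ _ (begin
    Z + (s * u * s * t * Z + d * s * Z) * u         ≡⟨ sym (ring₁ s u d t Z) ⟩
    suc (s * u * (d + s * u * t)) * Z               ≡⟨ cong (λ y → suc (s * u * y) * Z) (sym geo≡) ⟩
    suc (s * u * geometricSum (suc (s * u)) d) * Z  ≡⟨ cong (_* Z) (sym ([1+d]^k≡1+d*geometricSum (s * u) d)) ⟩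
    suc (s * u) ^ d * Z                             ≡⟨ fixes ⟩
    Z + P * u * K                                   ≡⟨ ring₃ Z P u K ⟩
    Z + P * K * u                                   ∎))
    where open ≡-Reasoning

module Chain {P u s : ℕ} .{{_ : NonZero u}} (z : ℕ → ℕ)
  (chain : ∀ i → ∃[ k ] suc (s * u) * z (suc i) ≡ z i + P * u * k) where

  chain^ : ∀ a d → ∃[ K ] suc (s * u) ^ d * z (d + a) ≡ z a + P * u * K
  chain^ a zero    = 0 , trans (*-identityˡ (z a)) (sym (trans (cong (z a +_) (*-zeroʳ (P * u))) (+-identityʳ (z a))))
  chain^ a (suc d) with chain^ a d | chain (d + a)
  ... | K , eqK | k , eqk = K + y ^ d * k , (begin
    y * y ^ d * z (suc (d + a))             ≡⟨ ring₁ y (y ^ d) (z (suc (d + a))) ⟩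
    y ^ d * (y * z (suc (d + a)))           ≡⟨ cong (y ^ d *_) eqk ⟩
    y ^ d * (z (d + a) + P * u * k)         ≡⟨ *-distribˡ-+ (y ^ d) _ _ ⟩
    y ^ d * z (d + a) + y ^ d * (P * u * k) ≡⟨ cong (_+ y ^ d * (P * u * k)) eqK ⟩
    z a + P * u * K + y ^ d * (P * u * k)   ≡⟨ ring₂ (z a) (P * u) K (y ^ d) k ⟩
    z a + P * u * (K + y ^ d * k)           ∎)
    where
    open ≡-Reasoning
    y = suc (s * u)
    ring₁ : ∀ y Y Z → y * Y * Z ≡ Y * (y * Z)
    ring₁ = solve-∀
    ring₂ : ∀ Z Q K Y k → Z + Q * K + Y * (Q * k) ≡ Z + Q * (K + Y * k)
    ring₂ = solve-∀

  chain-%u : ∀ i → z i % u ≡ z 0 % u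
  chain-%u zero    = refl
  chain-%u (suc i) with chain i
  ... | k , eqk = begin
    z (suc i) % u                        ≡⟨ sym ([m+kn]%n≡m%n (z (suc i)) (s * z (suc i)) u) ⟩
    (z (suc i) + s * z (suc i) * u) % u  ≡⟨ cong (_% u) (ring s u (z (suc i))) ⟩
    (suc (s * u) * z (suc i)) % u        ≡⟨ cong (_% u) eqk ⟩
    (z i + P * u * k) % u                ≡⟨ cong (_% u) (ring′ (z i) P u k) ⟩
    (z i + P * k * u) % u                ≡⟨ [m+kn]%n≡m%n (z i) (P * k) u ⟩
    z i % u                              ≡⟨ chain-%u i ⟩
    z 0 % u                              ∎
    where
    open ≡-Reasoning
    ring : ∀ s u Z → Z + s * Z * u ≡ suc (s * u) * Z
    ring = solve-∀
    ring′ : ∀ Z P u k → Z + P * u * k ≡ Z + P * k * u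
    ring′ = solve-∀

  chain-% : ∀ {q} .{{_ : NonZero q}} → q ∣ u → ∀ i → z i % q ≡ z 0 % q
  chain-% {q} q∣u i = begin
    z i % q      ≡⟨ sym (m∣n⇒o%n%m≡o%m q u (z i) q∣u) ⟩
    z i % u % q  ≡⟨ cong (_% q) (chain-%u i) ⟩
    z 0 % u % q  ≡⟨ m∣n⇒o%n%m≡o%m q u (z 0) q∣u ⟩
    z 0 % q      ∎
    where open ≡-Reasoning

  same-block⇒≡ : ∀ a b → z a / u ≡ z b / u → z a ≡ z b
  same-block⇒≡ a b za/u≡zb/u = begin
    z a                    ≡⟨ m≡m%n+[m/n]*n (z a) u ⟩
    z a % u + z a / u * u  ≡⟨ cong₂ (λ r q → r + q * u) (trans (chain-%u a) (sym (chain-%u b))) za/u≡zb/u ⟩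
    z b % u + z b / u * u  ≡⟨ sym (m≡m%n+[m/n]*n (z b) u) ⟩
    z b                    ∎
    where open ≡-Reasoning

  -- Pigeonhole on the blocks [q u, (q + 1) u) among z 0, …, z (P − 1) gives z a ≡ z b with 0 < b − a < P,
  -- and then ^-fixes⇒∣ forces P ∣ (b − a) s z a, which is impossible unless P ∣ z 0.
  bounded-chain⇒∣ : Prime P → P ∣ u → ¬ P ∣ s → (∀ i → z i < (P ∸ 1) * u) → P ∣ z 0
  bounded-chain⇒∣ pp P∣u P∤s z<[P-1]u with P ∣? z 0
  ... | yes P∣z₀ = P∣z₀
  ... | no  P∤z₀ = contradiction (Fin.pigeonhole P-1<P block) no-collision
    where
    instance _ = prime⇒nonZero pp
    P-1<P : P ∸ 1 < P
    P-1<P = ∸-monoʳ-< z<s (>-nonZero⁻¹ P)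
    block : Fin P → Fin (P ∸ 1)
    block i = fromℕ< (m<n*o⇒m/o<n (z<[P-1]u (toℕ i)))
    no-collision : ¬ (∃[ a ] ∃[ b ] a Fin.< b × block a ≡ block b)
    no-collision (a , b , a<b , same-block) = prime∤*⁺ pp (prime∤*⁺ pp P∤d P∤s) P∤za P∣dsZ
      where
      za≡zb : z (toℕ a) ≡ z (toℕ b)
      za≡zb = same-block⇒≡ (toℕ a) (toℕ b)
        (trans (sym (Fin.toℕ-fromℕ< _)) (trans (cong toℕ same-block) (Fin.toℕ-fromℕ< _)))
      d = toℕ b ∸ toℕ a
      P∤d : ¬ P ∣ d
      P∤d P∣d = <⇒≱ (≤-<-trans (m∸n≤m (toℕ b) (toℕ a)) (Fin.toℕ<n b)) (∣⇒≤ {{>-nonZero (m<n⇒0<n∸m a<b)}} P∣d)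
      P∤za : ¬ P ∣ z (toℕ a)
      P∤za P∣za = P∤z₀ (m%n≡0⇒n∣m (z 0) P (trans (sym (chain-% P∣u (toℕ a))) (n∣m⇒m%n≡0 _ P P∣za)))
      P∣dsZ : P ∣ d * s * z (toℕ a)
      P∣dsZ with chain^ (toℕ a) d
      ... | K , eqK = ^-fixes⇒∣ P∣u s d (z (toℕ a)) K
        (subst (λ Z → suc (s * u) ^ d * Z ≡ z (toℕ a) + P * u * K)
          (trans (cong z (m∸n+n≡m (<⇒≤ a<b))) (sym za≡zb)) eqK)

3*z≤P*u⇒z<[P∸1]*u : ∀ {z P u} .{{_ : NonZero u}} → 2 ≤ P → 3 * z ≤ P * u → z < (P ∸ 1) * u
3*z≤P*u⇒z<[P∸1]*u {z} {suc (suc P′)} {u} (s≤s (s≤s z≤n)) 3z≤Pu = *-cancelˡ-< 3 z (suc P′ * u) (begin-strict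
  3 * z                                ≤⟨ 3z≤Pu ⟩
  suc (suc P′) * u                     <⟨ m<m+n _ (>-nonZero⁻¹ _ {{m*n≢0 (suc (2 * P′)) u}}) ⟩
  suc (suc P′) * u + suc (2 * P′) * u  ≡⟨ ring P′ u ⟩
  3 * (suc P′ * u)                     ∎)
  where
  open ≤-Reasoning
  ring : ∀ P u → (2 + P) * u + (1 + 2 * P) * u ≡ 3 * ((1 + P) * u)
  ring = solve-∀

cycle-elements-divisible : ∀ {g′ P u s n} .{{_ : NonZero u}} → 3 ≤ g′ → Prime P → P ∣ u → ¬ P ∣ s →
  suc g′ ^ n ≡ suc (s * u) → (c : ExtremeCycle (suc g′) (P * u)) → ∀ j → ℤ.+ P ℤ.∣ ExtremeCycle.x c j
cycle-elements-divisible {g′@(suc _)} {P} {u} {s} {n} 3≤g′ pp P∣u P∤s g^n≡1+su c j =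
  ℤ.∣ᵤ⇒∣ (Chain.bounded-chain⇒∣ z chain pp P∣u P∤s z<[P-1]u)
  where
  open CycleBounds c
  orbit : ℕ → Fin (suc (ExtremeCycle.n c))
  orbit zero    = j
  orbit (suc i) = proj₁ (predecessor^ c n (orbit i))
  z : ℕ → ℕ
  z i = ∣x∣ (orbit i)
  chain : ∀ i → ∃[ k ] suc (s * u) * z (suc i) ≡ z i + P * u * k
  chain i = let (_ , k , eq) = predecessor^ c n (orbit i) in
    k , subst (λ y → y * z (suc i) ≡ z i + P * u * k) g^n≡1+su eq
  z<[P-1]u : ∀ i → z i < (P ∸ 1) * u
  z<[P-1]u i = 3*z≤P*u⇒z<[P∸1]*u (prime>1 pp) (≤-trans (*-monoˡ-≤ (z i) 3≤g′) (g′*∣x∣≤m (orbit i)))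

-- Descent

module Descent (g′ : ℕ) (3≤g′ : 3 ≤ g′) {r : ℕ} (p : Fin r → ℕ) (p-injective : Injective _≡_ _≡_ p)
  (p-prime : ∀ i → Prime (p i)) (p-odd : ∀ i → ¬ 2 ∣ p i)
  (o : Fin r → ℕ) (o-order : ∀ i → IsOrder (suc g′) (p i) (o i))
  (ι : Fin r → ℕ) (ι-iota : ∀ i → IsIota (suc g′) (p i) (o i) (ι i))
  (j : Fin r → ℕ) (j-maxExp : ∀ i → IsMaxExp (p i) (lcmFin r o) (j i)) where

  g = suc g′

  ∏p^ : (Fin r → ℕ) → ℕ
  ∏p^ e = prodFin r (λ i → p i ^ e i)

  instance
    p≢0 : ∀ {i} → NonZero (p i)
    p≢0 {i} = prime⇒nonZero (p-prime i)

  ∏p^≢0 : ∀ e → NonZero (∏p^ e)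
  ∏p^≢0 e = prodFin≢0 r _ (λ i → m^n≢0 (p i) (e i))

  ∏p^-pred : ∀ e i → 1 ≤ e i → ∏p^ e ≡ p i * ∏p^ (updateAt e i pred)
  ∏p^-pred e i 1≤ei = trans (prodFin-cong r (λ k → cong (p k ^_) (sym (e≗ k))))
                            (prodFin-^-updateAt-suc r p (updateAt e i pred) i)
    where
    e≗ : ∀ k → updateAt (updateAt e i pred) i suc k ≡ e k
    e≗ k = trans (updateAt-updateAt-local i e (suc-pred (e i) {{>-nonZero 1≤ei}}) k) (updateAt-id i e k)

  p∤∏p^-without : ∀ f i → ¬ p i ∣ ∏p^ (updateAt f i (const 0))
  p∤∏p^-without f i = prime∤prodFin r _ (p-prime i) p∤factor
    where
    p∤factor : ∀ k → ¬ p i ∣ p k ^ updateAt f i (const 0) k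
    p∤factor k with k Fin.≟ i
    ... | yes refl rewrite updateAt-updates i {const 0} f = prime∤1 (p-prime i)
    ... | no  k≢i  rewrite updateAt-minimal k i {const 0} f k≢i =
      λ pi∣pk^fk → k≢i (sym (p-injective (prime∣prime^⇒≡ (p-prime i) (p-prime k) (f k) pi∣pk^fk)))

  -- With P = p i, the exponent n = o i · P^t · L′ · R′ makes P^(ι i + t) = P^(f i) divide g^n − 1 exactly
  -- (P ∤ L′ R′), while o k · p k ^ f k ∣ n, hence p k ^ f k ∣ g^n − 1, for every other k.
  g^n≡1+s*∏p^ : ∀ f i → ι i + j i ≤ f i → ∃[ n ] ∃[ s ] g ^ n ≡ suc (s * ∏p^ f) × ¬ p i ∣ s
  g^n≡1+s*∏p^ f i ιj≤f with maxExp⇒cofactor (j-maxExp i)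
  ... | L′ , L≡L′*P^j , P∤L′ =
    n , ≡1[mod]exactly⇒cofactor {a = f i} (p-prime i) (∣prodFin r (λ k → p k ^ f k) i) ∏p^f∣g^n∸1 g^n≡1
    where
    P = p i
    t = f i ∸ ι i
    ι+t≡f : ι i + t ≡ f i
    ι+t≡f = m+[n∸m]≡n (m+n≤o⇒m≤o (ι i) ιj≤f)
    j≤t : j i ≤ t
    j≤t = +-cancelˡ-≤ (ι i) (j i) t (subst (ι i + j i ≤_) (sym ι+t≡f) ιj≤f)
    R′ = ∏p^ (updateAt f i (const 0))
    n = o i * (P ^ t * (L′ * R′))

    g^n≡1 : g ^ n ≡1[mod P ^ f i ]exactly
    g^n≡1 = subst₂ (λ y a → y ≡1[mod P ^ a ]exactly)
      (trans (^-*-assoc (g ^ o i) (P ^ t) _) (^-*-assoc g (o i) _)) ι+t≡f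
      (^-prime^-coprime-≡1[mod]exactly (p-prime i) (p-odd i) (proj₁ (ι-iota i))
        (prime∤*⁺ (p-prime i) P∤L′ (p∤∏p^-without f i)) (iota⇒≡1[mod]exactly (o-order i) (ι-iota i)) t)

    o*p^f∣n : ∀ k → k ≢ i → o k * p k ^ f k ∣ n
    o*p^f∣n k k≢i = ∣-trans (*-pres-∣ ok∣P^t*L′ pk^fk∣R′) (divides (o i) (ring (o i) (P ^ t) L′ R′))
      where
      ok∣P^t*L′ : o k ∣ P ^ t * L′
      ok∣P^t*L′ = ∣-trans (∣lcmFin r o k) (subst (_∣ P ^ t * L′) (sym L≡L′*P^j)
        (subst (_∣ P ^ t * L′) (*-comm (P ^ j i) L′) (*-pres-∣ (^-monoʳ-∣ P j≤t) ∣-refl)))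
      pk^fk∣R′ : p k ^ f k ∣ R′
      pk^fk∣R′ = subst (λ e → p k ^ e ∣ R′) (updateAt-minimal k i f k≢i) (∣prodFin r _ k)
      ring : ∀ o Q L R → o * (Q * (L * R)) ≡ o * (Q * L * R)
      ring = solve-∀

    ∏p^f∣g^n∸1 : ∏p^ f ∣ g ^ n ∸ 1
    ∏p^f∣g^n∸1 = prime-powers-∣ r p f p-injective p-prime pk^fk∣g^n∸1
      where
      pk^fk∣g^n∸1 : ∀ k → p k ^ f k ∣ g ^ n ∸ 1
      pk^fk∣g^n∸1 k with k Fin.≟ i
      ... | yes refl = ≡1[mod]⇒∣∸1 (≡1[mod]exactly⇒≡1[mod] {a = f i} g^n≡1)
      ... | no  k≢i  = ≡1[mod]⇒∣∸1 (order*^∣⇒≡1[mod] (o-order k) (f k) (o*p^f∣n k k≢i))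

  reduce : ∀ e i → ι i + j i < e i → NontrivialCycle g (∏p^ e) → NontrivialCycle g (∏p^ (updateAt e i pred))
  reduce e i ιj<ei nontrivial =
    let (n , s , g^n≡1+s*u , p∤s) = g^n≡1+s*∏p^ e′ i ιj≤e′i
        (c , x≢0)                 = subst (NontrivialCycle g) (∏p^-pred e i 1≤ei) nontrivial
    in nontrivial-divideOut (p i) c
         (cycle-elements-divisible {n = n} {{∏p^≢0 e′}} 3≤g′ (p-prime i) p∣∏p^e′ p∤s g^n≡1+s*u c) x≢0
    where
    e′ = updateAt e i pred
    1≤ei : 1 ≤ e i
    1≤ei = ≤-trans (s≤s z≤n) ιj<ei
    ιj≤e′i : ι i + j i ≤ e′ i
    ιj≤e′i = subst (ι i + j i ≤_) (sym (updateAt-updates i e)) (pred-mono-≤ ιj<ei)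
    p∣∏p^e′ : p i ∣ ∏p^ e′
    p∣∏p^e′ = ∣-trans (p∣p^ (p i) (≤-trans (proj₁ (ι-iota i)) (m+n≤o⇒m≤o (ι i) ιj≤e′i)))
                      (∣prodFin r (λ k → p k ^ e′ k) i)

  descend : ∀ fuel e → ∏p^ e ≤ fuel → NontrivialCycle g (∏p^ e) → NontrivialCycle g (∏p^ (λ i → ι i + j i))
  descend fuel e ∏≤fuel nontrivial with Fin.any? (λ i → ι i + j i <? e i)
  ... | no ¬exceeds = nontrivial-∣ {{∏p^≢0 (λ i → ι i + j i)}}
    (prodFin-mono-∣ r (λ i → ^-monoʳ-∣ (p i) (≮⇒≥ (λ exceeds → ¬exceeds (i , exceeds))))) nontrivial
  descend zero       e ∏≤0      nontrivial | yes _ = contradiction ∏≤0 (<⇒≱ (>-nonZero⁻¹ _ {{∏p^≢0 e}}))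
  descend (suc fuel) e ∏≤1+fuel nontrivial | yes (i , exceeds) =
    descend fuel e′ (≤-pred (≤-trans ∏e′<∏e ∏≤1+fuel)) (reduce e i exceeds nontrivial)
    where
    e′ = updateAt e i pred
    ∏e′<∏e : ∏p^ e′ < ∏p^ e
    ∏e′<∏e = subst (∏p^ e′ <_) (trans (*-comm _ (p i)) (sym (∏p^-pred e i (≤-trans (s≤s z≤n) exceeds))))
      (m<m*n (∏p^ e′) (p i) {{∏p^≢0 e′}} (prime>1 (p-prime i)))

theorem2p26 : (g : ℕ) → 4 ≤ g → 2 ∣ g →
    (r : ℕ) (p : Fin r → ℕ) → Injective _≡_ _≡_ p →
    (∀ i → Prime (p i)) → (∀ i → ¬ 2 ∣ p i) → (∀ i → Coprime (p i) g) →
    (o : Fin r → ℕ) → (∀ i → IsOrder g (p i) (o i)) →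
    (ι : Fin r → ℕ) → (∀ i → IsIota g (p i) (o i) (ι i)) →
    (j : Fin r → ℕ) → (∀ i → IsMaxExp (p i) (lcmFin r o) (j i)) →
    Complete g (prodFin r (λ i → p i ^ (ι i + j i))) →
    (k : Fin r → ℕ) → Complete g (prodFin r (λ i → p i ^ k i))
theorem2p26 (suc g′) (s≤s 3≤g′) _ r p p-injective p-prime p-odd _ o o-order ι ι-iota j j-maxExp complete k c i
  with ExtremeCycle.x c i ℤ.≟ ℤ.+ 0
... | yes xi≡0 = xi≡0
... | no  xi≢0 = contradiction (descend (∏p^ k) k ≤-refl (c , i , xi≢0)) (complete⇒¬nontrivial complete)
  where
  open Descent g′ 3≤g′ p p-injective p-prime p-odd o o-order ι ι-iota j j-maxExp
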